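{- At any stable state of a black-white array with deletions (as defined in the context), the occupancy rate of every active segment is strictly greater than $50\%$.
   Context: Black-white array (BWA) of size $N=2^K$: values from a totally ordered set are stored in a white array $W$ (indices $1,\dots,N-1$) and a black array $B$ (indices $1,\dots,N/2-1$); the segment of rank $j$ of an array is the index range $[2^j,2^{j+1}-1]$. A state variable $\mathtt{total}$ counts stored entries (a special marker VOID left by a deletion counts as an entry); the segment of rank $i$ is active iff bit $i$ of $\mathtt{total}$ is $1$. A stable state is a state after an operation has completed; then all stored entries lie in active white segments, each sorted ascending (ignoring VOIDs). Insertion: a new value goes to $W[1]$ if rank $0$ is inactive, else to $B[1]$ followed by merge of rank $0$, where merge of rank $i$ merges the black and white segments of rank $i$ into the white segment of rank $i+1$ if that is inactive, and otherwise into the black segment of rank $i+1$ followed by merge of rank $i+1$; then $\mathtt{total}$ increases by one. The occupancy vector $V$ has $V[i]=$ number of non-VOID values in the white segment of rank $i$; the occupancy rate of segment $i$ is $V[i]/2^i$. Delete$(v)$: search for $v$ among the active segments; if found, replace it by VOID and decrement $V[i]$ for its segment rank $i$; if then $V[i]\le 2^{i-1}$, the segment of rank $i$ is demoted: its non-VOID values (sorted) are copied to rank $i-1$. If the segment of rank $i-1$ is inactive they are placed in the white segment of rank $i-1$, which becomes active while rank $i$ becomes inactive. If the segment of rank $i-1$ is active they are placed in the black segment of rank $i-1$, and the black and white segments of rank $i-1$ are merged, the result being put back into the white segment of rank $i$ (rank $i$ stays active, rank $i-1$ becomes inactive, $V$ and $\mathtt{total}$ updated accordingly). -}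

module Defs where

open import Level using (_⊔_)
open import Data.Nat using (ℕ; zero; suc; _+_; _*_; _∸_; _^_; _≤_; _<_; _≡ᵇ_)
open import Data.Nat.DivMod using (_/_; _%_)
open import Data.Bool using (Bool; true; false; if_then_else_)
open import Data.Maybe using (Maybe; just; nothing)
open import Data.List using (List; []; _∷_; length; map; replicate; _++_; catMaybes; merge; lookup; _[_]∷=_; filter)
open import Data.Fin using (Fin)
open import Data.Product using (Σ; ∃; _×_; _,_)
open import Relation.Binary.Bundles using (DecTotalOrder)
open import Relation.Binary.PropositionalEquality using (_≡_)
open import Relation.Nullary using (¬_)

bit : ℕ → ℕ → ℕ
bit n zero    = n % 2
bit n (suc i) = bit (n / 2) i

upd : ∀ {a} {A : Set a} → (ℕ → A) → ℕ → A → (ℕ → A)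
upd f i x j = if i ≡ᵇ j then x else f j

module BWA {c ℓ₁ ℓ₂} (O : DecTotalOrder c ℓ₁ ℓ₂) where
  open DecTotalOrder O using (_≈_; _≤?_) renaming (Carrier to A)

  Entry : Set c
  Entry = Maybe A

  VOID : Entry
  VOID = nothing

  -- The state: for each rank j, the content of the white segment W[2^j .. 2^(j+1)-1]
  -- and of the black segment B[2^j .. 2^(j+1)-1], listed in index order,
  -- together with the counter total.
  record State : Set c where
    constructor mkState
    field
      total : ℕ
      white : ℕ → List Entry
      black : ℕ → List Entry
  open State public

  empty : State
  empty = mkState 0 (λ _ → []) (λ _ → [])

  Active : State → ℕ → Set
  Active s i = bit (total s) i ≡ 1

  Inactive : State → ℕ → Set
  Inactive s i = bit (total s) i ≡ 0

  countVoid : List Entry → ℕ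
  countVoid []            = 0
  countVoid (nothing ∷ l) = suc (countVoid l)
  countVoid (just _ ∷ l)  = countVoid l

  V : State → ℕ → ℕ
  V s i = length (catMaybes (white s i))

  -- merging two segments: the non-VOID values are merged in ascending order,
  -- the VOID entries (which are entries, counted by total) are kept, placed after them
  mergeSeg : List Entry → List Entry → List Entry
  mergeSeg xs ys =
    map just (merge _≤?_ (catMaybes xs) (catMaybes ys))
      ++ replicate (countVoid xs + countVoid ys) VOID

  setW : ℕ → List Entry → State → State
  setW i l s = mkState (total s) (upd (white s) i l) (black s)

  setB : ℕ → List Entry → State → State
  setB i l s = mkState (total s) (white s) (upd (black s) i l)

  setTotal : ℕ → State → State
  setTotal t s = mkState t (white s) (black s)

  merged : State → ℕ → List Entry
  merged s i = mergeSeg (black s i) (white s i)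

  cleared : State → ℕ → State
  cleared s i = setB i [] (setW i [] s)

  -- Merge i s s' : the merge of rank i, started in state s, ends in state s'
  -- (total is not modified during the cascade; it is incremented afterwards)
  data Merge : ℕ → State → State → Set c where
    toWhite : ∀ {i s} → Inactive s (suc i) →
              Merge i s (setW (suc i) (merged s i) (cleared s i))
    toBlack : ∀ {i s s'} → Active s (suc i) →
              Merge (suc i) (setB (suc i) (merged s i) (cleared s i)) s' →
              Merge i s s'

  data Insert (v : A) (s : State) : State → Set c where
    ins-white : Inactive s 0 →
                Insert v s (setTotal (suc (total s)) (setW 0 (just v ∷ []) s))
    ins-black : ∀ {s'} → Active s 0 →
                Merge 0 (setB 0 (just v ∷ []) s) s' →
                Insert v s (setTotal (suc (total s)) s')

  Occurs : State → A → ℕ → Set (c ⊔ ℓ₁)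
  Occurs s v i = Active s i × Σ (Fin (length (white s i))) λ p →
                   Σ A λ x → (lookup (white s i) p ≡ just x) × (x ≈ v)

  data Demote : ℕ → State → State → Set c where
    -- rank 0: there is no rank -1; the segment simply becomes inactive
    dem-zero : ∀ {s} →
      Demote 0 s (setTotal (total s ∸ 1) (setW 0 [] s))
    dem-white : ∀ {j s} → Inactive s j →
      Demote (suc j) s
        (setTotal (total s ∸ 2 ^ j)
          (setW (suc j) [] (setW j (map just (catMaybes (white s (suc j)))) s)))
    dem-merge : ∀ {j s} → Active s j →
      let s₁ = setB j (map just (catMaybes (white s (suc j)))) s in
      Demote (suc j) s
        (setTotal (total s ∸ 2 ^ j) (cleared (setW (suc j) (merged s₁ j) s₁) j))

  data Delete (v : A) (s : State) : State → Set (c ⊔ ℓ₁) where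
    del-absent : (∀ i → ¬ Occurs s v i) → Delete v s s
    del-keep   : ∀ i (o : Occurs s v i) →
      let (_ , p , _) = o
          s₁ = setW i (white s i [ p ]∷= VOID) s in
      ¬ (2 * V s₁ i ≤ 2 ^ i) → Delete v s s₁
    del-demote : ∀ i (o : Occurs s v i) {s'} →
      let (_ , p , _) = o
          s₁ = setW i (white s i [ p ]∷= VOID) s in
      2 * V s₁ i ≤ 2 ^ i → Demote i s₁ s' → Delete v s s'

  -- one completed operation on a BWA of size N = 2^K
  -- (an insertion requires room: total stays ≤ N - 1)
  data Step (K : ℕ) (s : State) : State → Set (c ⊔ ℓ₁) where
    insert : ∀ v {s'} → suc (total s) < 2 ^ K → Insert v s s' → Step K s s'
    delete : ∀ v {s'} → Delete v s s' → Step K s s'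

  data Stable (K : ℕ) : State → Set (c ⊔ ℓ₁) where
    init : Stable K empty
    step : ∀ {s s'} → Stable K s → Step K s s' → Stable K s'

module Submission where

-- The proof is an invariant argument.  Call a state half-full when every active
-- white segment of rank k holds more than 2^(k-1) values, i.e. 2^k < 2 * V[k].
-- The empty array is trivially half-full, and each completed operation preserves
-- the property, so by induction on the reachability derivation every stable state
-- is half-full.

open import Defs
open import Data.Bool using (true; false)
open import Data.Nat hiding (_≤?_)
open import Data.Nat.Properties hiding (_≤?_)
open import Data.Nat.DivMod
open import Data.Nat.Tactic.RingSolver using (solve-∀)
open import Data.Maybe using (Maybe; just; nothing)
open import Data.List using (List; []; _∷_; length; map; replicate; _++_; catMaybes; merge; lookup; _[_]∷=_)
open import Data.List.Properties using (catMaybes-++; length-++)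
open import Data.List.Relation.Binary.Permutation.Propositional.Properties using (merge-↭; ↭-length)
open import Data.Fin using (Fin)
import Data.Fin as Fin
open import Data.Product using (Σ; _×_; _,_)
open import Data.Sum using (_⊎_; inj₁; inj₂) renaming (map to ⊎-map)
open import Data.Empty using (⊥; ⊥-elim)
open import Relation.Nullary using (Dec; yes; no)
open import Relation.Binary.Bundles using (DecTotalOrder)
open import Relation.Binary.PropositionalEquality

-- Binary view of a number: n = d + 2h with a digit d < 2.  Bit 0 of n is d and
-- the higher bits of n are the bits of h; every inductive argument on bits below
-- peels off the lowest digit this way.
data Digits : ℕ → Set where
  digits : ∀ d h → d < 2 → Digits (d + h * 2)

digit₀ : 0 < 2
digit₀ = s≤s z≤n

digit₁ : 1 < 2
digit₁ = s≤s (s≤s z≤n)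

digits-view : ∀ n → Digits n
digits-view n = subst Digits (sym (m≡m%n+[m/n]*n n 2)) (digits (n % 2) (n / 2) (m%n<n n 2))

bit-low : ∀ {d} h → d < 2 → bit (d + h * 2) 0 ≡ d
bit-low {d} h d<2 = trans ([m+kn]%n≡m%n d h 2) (m<n⇒m%n≡m d<2)

bit-high : ∀ {d} h k → d < 2 → bit (d + h * 2) (suc k) ≡ bit h k
bit-high {d} h k d<2 = cong (λ m → bit m k) halve
  where
  no-carry : d % 2 + h * 2 % 2 < 2
  no-carry = subst₂ (λ a b → a + b < 2) (sym (m<n⇒m%n≡m d<2)) (sym (m*n%n≡0 h 2))
               (subst (_< 2) (sym (+-identityʳ d)) d<2)
  halve : (d + h * 2) / 2 ≡ h
  halve = trans (+-distrib-/ d (h * 2) no-carry) (cong₂ _+_ (m<n⇒m/n≡0 d<2) (m*n/n≡m h 2))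

-- Adding 2^(j+1) to d + 2h adds 2^j to the upper half h (write p = 2^j).
shift-digit : ∀ p d h → 2 * p + (d + h * 2) ≡ d + (p + h) * 2
shift-digit = solve-∀

bit-of-zero : ∀ k → bit 0 k ≡ 0
bit-of-zero zero    = refl
bit-of-zero (suc k) = bit-of-zero k

bit-clash : ∀ {b} → b ≡ 0 → b ≡ 1 → ⊥
bit-clash clear set = 0≢1+n (trans (sym clear) set)

-- Adding 2^j to a number whose bit j is clear causes no carry: all bits other
-- than j are unchanged.
addBit-others : ∀ j {u} k → k ≢ j → bit u j ≡ 0 → bit (2 ^ j + u) k ≡ bit u k
addBit-others j {u} k k≢j clear with digits-view u
addBit-others zero zero    k≢j clear | digits _ h _ = ⊥-elim (k≢j refl)
addBit-others zero (suc k) k≢j clear | digits _ h (s≤s z≤n) =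
  trans (bit-high h k digit₁) (sym (bit-high h k digit₀))
addBit-others zero (suc k) k≢j clear | digits _ h (s≤s (s≤s z≤n)) =
  ⊥-elim (bit-clash clear (bit-low h digit₁))
addBit-others (suc j) k k≢j clear | digits d h d<2 = begin
  bit (2 ^ suc j + (d + h * 2)) k ≡⟨ cong (λ n → bit n k) (shift-digit (2 ^ j) d h) ⟩
  bit (d + (2 ^ j + h) * 2) k     ≡⟨ same-bits k k≢j ⟩
  bit (d + h * 2) k               ∎
  where
  open ≡-Reasoning
  same-bits : ∀ k → k ≢ suc j → bit (d + (2 ^ j + h) * 2) k ≡ bit (d + h * 2) k
  same-bits zero    _       = trans (bit-low (2 ^ j + h) d<2) (sym (bit-low h d<2))
  same-bits (suc k) k≢1+j = begin
    bit (d + (2 ^ j + h) * 2) (suc k) ≡⟨ bit-high (2 ^ j + h) k d<2 ⟩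
    bit (2 ^ j + h) k                 ≡⟨ addBit-others j k (λ k≡j → k≢1+j (cong suc k≡j))
                                                         (trans (sym (bit-high h j d<2)) clear) ⟩
    bit h k                           ≡⟨ bit-high h k d<2 ⟨
    bit (d + h * 2) (suc k)           ∎

clearBit : ∀ j {t} → bit t j ≡ 1 → Σ ℕ λ u → t ≡ 2 ^ j + u × bit u j ≡ 0
clearBit j {t} set with digits-view t
clearBit zero    set | digits _ h (s≤s z≤n)       = ⊥-elim (bit-clash (bit-low h digit₀) set)
clearBit zero    set | digits _ h (s≤s (s≤s z≤n)) = h * 2 , refl , bit-low h digit₀
clearBit (suc j) set | digits d h d<2 with clearBit j (trans (sym (bit-high h j d<2)) set)
... | u , refl , clear = d + u * 2 , sym (shift-digit (2 ^ j) d u) , trans (bit-high u j d<2) clear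

carry : ∀ m t → (∀ k → k < m → bit t k ≡ 1) → bit t m ≡ 0 →
        ∀ k → bit (suc t) k ≡ 1 → k ≡ m ⊎ (m < k × bit t k ≡ 1)
carry m t ones clear k set with digits-view t
carry zero    _ ones clear k       set | digits _ h (s≤s (s≤s z≤n)) = ⊥-elim (bit-clash clear (bit-low h digit₁))
carry zero    _ ones clear zero    set | digits _ h (s≤s z≤n) = inj₁ refl
carry zero    _ ones clear (suc k) set | digits _ h (s≤s z≤n) =
  inj₂ (s≤s z≤n , trans (bit-high h k digit₀) (trans (sym (bit-high h k digit₁)) set))
carry (suc m) _ ones clear k       set | digits _ h (s≤s z≤n) = ⊥-elim (bit-clash (bit-low h digit₀) (ones 0 (s≤s z≤n)))
carry (suc m) _ ones clear zero    set | digits _ h (s≤s (s≤s z≤n)) = ⊥-elim (bit-clash (bit-low (suc h) digit₀) set)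
carry (suc m) _ ones clear (suc k) set | digits _ h (s≤s (s≤s z≤n)) =
  ⊎-map (cong suc) (λ (m<k , set-h) → s≤s m<k , trans (bit-high h k digit₁) set-h)
    (carry m h (λ k k<m → trans (sym (bit-high h k digit₁)) (ones (suc k) (s≤s k<m)))
               (trans (sym (bit-high h m digit₁)) clear)
               k (trans (sym (bit-high (suc h) k digit₀)) set))

clearBit-sub : ∀ j t → bit t j ≡ 1 → ∀ k → bit (t ∸ 2 ^ j) k ≡ 1 → k ≢ j × bit t k ≡ 1
clearBit-sub j t set k set-k with clearBit j set
... | u , refl , clear rewrite m+n∸m≡n (2 ^ j) u =
  k≢j , trans (addBit-others j k k≢j clear) set-k
  where
  k≢j : k ≢ j
  k≢j refl = bit-clash clear set-k

borrow-sub : ∀ j t → bit t j ≡ 0 → bit t (suc j) ≡ 1 → ∀ k → bit (t ∸ 2 ^ j) k ≡ 1 →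
             k ≡ j ⊎ (k ≢ j × k ≢ suc j × bit t k ≡ 1)
borrow-sub j t clear set k set-k with clearBit (suc j) {t} set
... | u , refl , clear-u = outcome
  where
  clear-j : bit u j ≡ 0
  clear-j = trans (sym (addBit-others (suc j) j (λ ()) clear-u)) clear
  halfway : 2 ^ suc j + u ∸ 2 ^ j ≡ 2 ^ j + u
  halfway = begin
    2 ^ suc j + u ∸ 2 ^ j       ≡⟨ cong (λ n → 2 ^ j + n + u ∸ 2 ^ j) (+-identityʳ (2 ^ j)) ⟩
    2 ^ j + 2 ^ j + u ∸ 2 ^ j   ≡⟨ cong (_∸ 2 ^ j) (+-assoc (2 ^ j) (2 ^ j) u) ⟩
    2 ^ j + (2 ^ j + u) ∸ 2 ^ j ≡⟨ m+n∸m≡n (2 ^ j) (2 ^ j + u) ⟩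
    2 ^ j + u                   ∎
    where open ≡-Reasoning
  outcome : k ≡ j ⊎ (k ≢ j × k ≢ suc j × bit (2 ^ suc j + u) k ≡ 1)
  outcome with k ≟ j
  ... | yes k≡j = inj₁ k≡j
  ... | no  k≢j = inj₂ (k≢j , k≢1+j , trans (addBit-others (suc j) k k≢1+j clear-u) set-u)
    where
    set-u : bit u k ≡ 1
    set-u = trans (sym (addBit-others j k k≢j clear-j)) (trans (cong (λ n → bit n k) (sym halfway)) set-k)
    k≢1+j : k ≢ suc j
    k≢1+j refl = bit-clash clear-u set-u

upd-here : ∀ {a} {A : Set a} (f : ℕ → A) i x → upd f i x i ≡ x
upd-here f i x with i ≡ᵇ i | ≡⇒≡ᵇ i i refl
... | true  | _  = refl
... | false | ()

upd-other : ∀ {a} {A : Set a} (f : ℕ → A) i x k → k ≢ i → upd f i x k ≡ f k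
upd-other f i x k k≢i with i ≡ᵇ k | ≡ᵇ⇒≡ i k
... | false | _   = refl
... | true  | i≡k = ⊥-elim (k≢i (sym (i≡k _)))

-- The number of values (non-VOID entries) of a segment; V s i is count (white s i).
count : ∀ {a} {A : Set a} → List (Maybe A) → ℕ
count l = length (catMaybes l)

module _ {a} {A : Set a} where

  count-++ : (xs ys : List (Maybe A)) → count (xs ++ ys) ≡ count xs + count ys
  count-++ xs ys = trans (cong length (catMaybes-++ xs ys)) (length-++ (catMaybes xs))

  count-just : (l : List A) → count (map just l) ≡ length l
  count-just []      = refl
  count-just (x ∷ l) = cong suc (count-just l)

  count-nothing : ∀ n → count (replicate {A = Maybe A} n nothing) ≡ 0
  count-nothing zero    = refl
  count-nothing (suc n) = count-nothing n

  count-values : (l : List (Maybe A)) → count (map just (catMaybes l)) ≡ count l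
  count-values l = count-just (catMaybes l)

  count-erase : ∀ (l : List (Maybe A)) (p : Fin (length l)) {x} → lookup l p ≡ just x →
                count l ≡ suc (count (l [ p ]∷= nothing))
  count-erase (just _  ∷ l) Fin.zero    _  = refl
  count-erase (just _  ∷ l) (Fin.suc p) lp = cong suc (count-erase l p lp)
  count-erase (nothing ∷ l) (Fin.suc p) lp = count-erase l p lp

-- n values fill more than half of a segment of rank i (which has 2^i cells).
MoreThanHalf : ℕ → ℕ → Set
MoreThanHalf i n = 2 ^ i < 2 * n

recount : ∀ i {m n} → m ≡ n → MoreThanHalf i n → MoreThanHalf i m
recount i m≡n = subst (MoreThanHalf i) (sym m≡n)

singleton-fills : MoreThanHalf 0 1
singleton-fills = s≤s (s≤s z≤n)

moreThanHalf-nonEmpty : ∀ i {n} → MoreThanHalf i n → 0 < n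
moreThanHalf-nonEmpty i {suc n} _ = s≤s z≤n

merge-moreThanHalf : ∀ i {b w} → MoreThanHalf i b → MoreThanHalf i w → MoreThanHalf (suc i) (b + w)
merge-moreThanHalf i {b} {w} b>half w>half = begin-strict
  2 * 2 ^ i     ≡⟨ cong (2 ^ i +_) (+-identityʳ (2 ^ i)) ⟩
  2 ^ i + 2 ^ i <⟨ +-mono-< b>half w>half ⟩
  2 * b + 2 * w ≡⟨ *-distribˡ-+ 2 b w ⟨
  2 * (b + w)   ∎
  where open ≤-Reasoning

half-remains : ∀ j {v} → MoreThanHalf (suc j) (suc v) → 2 ^ j ≤ v
half-remains j {v} >half = s≤s⁻¹ (*-cancelˡ-< 2 (2 ^ j) (suc v) >half)

half-fills-below : ∀ j {v} → 2 ^ j ≤ v → MoreThanHalf j v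
half-fills-below j {v} half = begin-strict
  2 ^ j ≤⟨ half ⟩
  v     <⟨ m<m+n v (≤-trans (m^n>0 2 j) half) ⟩
  v + v ≡⟨ cong (v +_) (+-identityʳ v) ⟨
  2 * v ∎
  where open ≤-Reasoning

half-plus-nonEmpty : ∀ j {v w} → 2 ^ j ≤ v → 0 < w → MoreThanHalf (suc j) (v + w)
half-plus-nonEmpty j {v} {w} half w>0 = begin-strict
  2 * 2 ^ j   ≤⟨ *-monoʳ-≤ 2 half ⟩
  2 * v       <⟨ *-monoʳ-< 2 (m<m+n v w>0) ⟩
  2 * (v + w) ∎
  where open ≤-Reasoning

module HalfFullness {c ℓ₁ ℓ₂} (O : DecTotalOrder c ℓ₁ ℓ₂) where
  open DecTotalOrder O using (_≤?_) renaming (Carrier to A)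
  open BWA O

  HalfFull : State → Set
  HalfFull s = ∀ k → Active s k → MoreThanHalf k (V s k)

  V-setW-here : ∀ i l s → V (setW i l s) i ≡ count l
  V-setW-here i l s = cong count (upd-here (white s) i l)

  V-setW-other : ∀ i l s k → k ≢ i → V (setW i l s) k ≡ V s k
  V-setW-other i l s k k≢i = cong count (upd-other (white s) i l k k≢i)

  count-setB-here : ∀ i l s → count (black (setB i l s) i) ≡ count l
  count-setB-here i l s = cong count (upd-here (black s) i l)

  -- A merge keeps all values of both segments (merge permutes their concatenation).
  count-merged : ∀ s i → count (merged s i) ≡ count (black s i) + V s i
  count-merged s i = begin
    count (map just sorted ++ replicate voids VOID)        ≡⟨ count-++ (map just sorted) _ ⟩
    count (map just sorted) + count (replicate voids VOID) ≡⟨ cong₂ _+_ (count-just sorted) (count-nothing voids) ⟩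
    length sorted + 0                                      ≡⟨ +-identityʳ _ ⟩
    length sorted                                          ≡⟨ ↭-length (merge-↭ _≤?_ bs ws) ⟩
    length (bs ++ ws)                                      ≡⟨ length-++ bs ⟩
    count (black s i) + V s i                              ∎
    where
    open ≡-Reasoning
    bs ws sorted : List A
    bs     = catMaybes (black s i)
    ws     = catMaybes (white s i)
    sorted = merge _≤?_ bs ws
    voids : ℕ
    voids = countVoid (black s i) + countVoid (white s i)

  merged-moreThanHalf : ∀ s i → MoreThanHalf i (count (black s i)) → MoreThanHalf i (V s i) →
                        MoreThanHalf (suc i) (count (merged s i))
  merged-moreThanHalf s i black>half white>half =
    recount (suc i) (count-merged s i) (merge-moreThanHalf i {count (black s i)} {V s i} black>half white>half)

  -- Ranks 0..i are active
  -- (the carry chain of the increment of total), the white segments of rank ≥ i are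
  -- more than half full, and so is the black segment of rank i.  Each merge step
  -- moves two more-than-half-full segments of rank r into one of rank r+1; at the
  -- end the active ranks of total+1 are exactly the filled ranks.
  merge-halfFull : ∀ {i s s'} → Merge i s s' →
    (∀ k → k ≤ i → Active s k) →
    (∀ k → i ≤ k → Active s k → MoreThanHalf k (V s k)) →
    MoreThanHalf i (count (black s i)) →
    ∀ k → bit (suc (total s)) k ≡ 1 → MoreThanHalf k (V s' k)
  merge-halfFull {i} {s} (toWhite inactive) carrying full black>half k active′
    with carry (suc i) (total s) (λ k k<1+i → carrying k (s≤s⁻¹ k<1+i)) inactive k active′
  ... | inj₁ refl = recount (suc i) (V-setW-here (suc i) (merged s i) (cleared s i))
                      (merged-moreThanHalf s i black>half (full i ≤-refl (carrying i ≤-refl)))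
  ... | inj₂ (1+i<k , active) =
    recount k (trans (V-setW-other (suc i) (merged s i) (cleared s i) k (>⇒≢ 1+i<k)) (V-setW-other i [] s k (>⇒≢ i<k)))
      (full k (<⇒≤ i<k) active)
    where
    i<k : i < k
    i<k = <-trans (n<1+n i) 1+i<k
  merge-halfFull {i} {s} (toBlack active cascade) carrying full black>half =
    merge-halfFull cascade carrying′ full′
      (recount (suc i) (count-setB-here (suc i) (merged s i) (cleared s i))
        (merged-moreThanHalf s i black>half (full i ≤-refl (carrying i ≤-refl))))
    where
    carrying′ : ∀ k → k ≤ suc i → Active s k
    carrying′ k k≤1+i with m≤n⇒m<n∨m≡n k≤1+i
    ... | inj₁ k<1+i = carrying k (s≤s⁻¹ k<1+i)
    ... | inj₂ refl  = active
    full′ : ∀ k → suc i ≤ k → Active s k → MoreThanHalf k (V (cleared s i) k)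
    full′ k i<k active-k = recount k (V-setW-other i [] s k (>⇒≢ i<k)) (full k (<⇒≤ i<k) active-k)

  insert-halfFull : ∀ {v s s'} → Insert v s s' → HalfFull s → HalfFull s'
  insert-halfFull {v} {s} (ins-white inactive) full k active′ with carry 0 (total s) (λ _ ()) inactive k active′
  ... | inj₁ refl = recount 0 (V-setW-here 0 (just v ∷ []) s) singleton-fills
  ... | inj₂ (0<k , active) = recount k (V-setW-other 0 (just v ∷ []) s k (>⇒≢ 0<k)) (full k active)
  insert-halfFull {v} {s} (ins-black active cascade) full =
    merge-halfFull cascade (λ { zero _ → active }) (λ k _ → full k)
      (recount 0 (count-setB-here 0 (just v ∷ []) s) singleton-fills)

  -- Demotion of rank i, which was more than half full before its last deletion
  -- while all other active segments are more than half full.  Rank i is vacated;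
  -- its values either fill the free rank i-1 or are merged back into rank i
  -- together with the non-empty rank i-1.
  demote-halfFull : ∀ {i s s'} → Demote i s s' → Active s i →
    (∀ k → k ≢ i → Active s k → MoreThanHalf k (V s k)) →
    MoreThanHalf i (suc (V s i)) → HalfFull s'
  demote-halfFull {s = s} dem-zero active full _ k active′ =
    let k≢0 , active-k = clearBit-sub 0 (total s) active k active′
    in recount k (V-setW-other 0 [] s k k≢0) (full k k≢0 active-k)
  demote-halfFull {suc j} {s} (dem-white inactive) active full >half k active′ =
    placed k (borrow-sub j (total s) inactive active k active′)
    where
    lowered : State
    lowered = setW j (map just (catMaybes (white s (suc j)))) s
    placed : ∀ k → k ≡ j ⊎ (k ≢ j × k ≢ suc j × Active s k) →
             MoreThanHalf k (V (setW (suc j) [] lowered) k)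
    placed .j (inj₁ refl) =
      recount j (trans (V-setW-other (suc j) [] lowered j (λ ()))
                (trans (V-setW-here j _ s) (count-values (white s (suc j)))))
        (half-fills-below j (half-remains j >half))
    placed k (inj₂ (k≢j , k≢1+j , active-k)) =
      recount k (trans (V-setW-other (suc j) [] lowered k k≢1+j) (V-setW-other j _ s k k≢j))
        (full k k≢1+j active-k)
  demote-halfFull {suc j} {s} (dem-merge active-j) active full >half k active′ =
    let k≢j , active-k = clearBit-sub j (total s) active-j k active′ in
    recount k (V-setW-other j [] remerged k k≢j) (upper k (k ≟ suc j) active-k)
    where
    demoted remerged : State
    demoted  = setB j (map just (catMaybes (white s (suc j)))) s
    remerged = setW (suc j) (merged demoted j) demoted
    grown : V remerged (suc j) ≡ V s (suc j) + V s j
    grown = begin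
      V remerged (suc j)                                     ≡⟨ V-setW-here (suc j) _ demoted ⟩
      count (merged demoted j)                               ≡⟨ count-merged demoted j ⟩
      count (black demoted j) + V s j                        ≡⟨ cong (_+ V s j) (count-setB-here j _ s) ⟩
      count (map just (catMaybes (white s (suc j)))) + V s j ≡⟨ cong (_+ V s j) (count-values (white s (suc j))) ⟩
      V s (suc j) + V s j                                    ∎
      where open ≡-Reasoning
    upper : ∀ k → Dec (k ≡ suc j) → Active s k → MoreThanHalf k (V remerged k)
    upper .(suc j) (yes refl) _ =
      recount (suc j) grown
        (half-plus-nonEmpty j (half-remains j >half) (moreThanHalf-nonEmpty j (full j (λ ()) active-j)))
    upper k (no k≢1+j) active-k =
      recount k (V-setW-other (suc j) _ demoted k k≢1+j) (full k k≢1+j active-k)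

  delete-halfFull : ∀ {v s s'} → Delete v s s' → HalfFull s → HalfFull s'
  delete-halfFull (del-absent _) full = full
  delete-halfFull {s = s} (del-keep i _ stays-full) full k active with k ≟ i
  ... | yes refl = ≰⇒> stays-full
  ... | no k≢i   = recount k (V-setW-other i _ s k k≢i) (full k active)
  delete-halfFull {s = s} (del-demote i (active , p , _ , at-p , _) _ demotion) full =
    demote-halfFull demotion active
      (λ k k≢i active-k → recount k (V-setW-other i _ s k k≢i) (full k active-k))
      (recount i (trans (cong suc (V-setW-here i _ s)) (sym (count-erase (white s i) p at-p))) (full i active))

  stable-halfFull : ∀ {K s} → Stable K s → HalfFull s
  stable-halfFull init k active = ⊥-elim (bit-clash (bit-of-zero k) active)
  stable-halfFull (step reachable (insert _ _ ins)) = insert-halfFull ins (stable-halfFull reachable)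
  stable-halfFull (step reachable (delete _ del))   = delete-halfFull del (stable-halfFull reachable)

mainTheorem4 : ∀ {c ℓ₁ ℓ₂} (O : DecTotalOrder c ℓ₁ ℓ₂) (K : ℕ) (s : BWA.State O) →
    BWA.Stable O K s → ∀ (i : ℕ) → BWA.Active O s i → 2 ^ i < 2 * BWA.V O s i
mainTheorem4 O K s reachable = HalfFullness.stable-halfFull O reachable
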